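{- Let $k\ge 3$ be an integer. Then, up to isomorphism, $K_{k+1,k+1}-PM$ is the unique graph $G$ satisfying the following three conditions: (1) $G$ is $k$-connected; (2) the independence number of $G$ is greater than $k$; (3) every independent set of vertices of $G$ of cardinality $k$ is a vertex cut of $G$ (i.e., deleting it leaves a disconnected graph).
   Context: All graphs are finite and simple. For an integer $s\ge 1$, $K_{s,s}-PM$ denotes the graph obtained from the complete bipartite graph $K_{s,s}$ (both partite sets of size $s$) by deleting all edges of a perfect matching of $K_{s,s}$. -}

module Defs where

open import Data.Nat using (ℕ; suc; _+_; _<_)
open import Data.Fin using (Fin; splitAt)
open import Data.Fin.Properties using (_≟_)
open import Data.Fin.Subset using (Subset; _∈_; _∉_; ∣_∣)
open import Data.Bool using (Bool; true; false; not)
open import Data.Sum using (_⊎_; inj₁; inj₂)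
open import Data.Product using (Σ; _×_; _,_)
open import Relation.Nullary using (¬_; yes; no)
open import Relation.Binary.PropositionalEquality using (_≡_; refl)
open import Function.Bundles using (_↔_; Inverse)

record Graph (n : ℕ) : Set where
  field
    adj   : Fin n → Fin n → Bool
    sym   : ∀ u v → adj u v ≡ adj v u
    irrefl : ∀ u → adj u u ≡ false
open Graph public

module _ {n : ℕ} (G : Graph n) where

  data Reach (S : Subset n) : Fin n → Fin n → Set where
    here : ∀ {u} → u ∉ S → Reach S u u
    step : ∀ {u w v} → u ∉ S → adj G u w ≡ true → Reach S w v → Reach S u v

  ConnectedMinus : Subset n → Set
  ConnectedMinus S = ∀ u v → u ∉ S → v ∉ S → Reach S u v

  DisconnectedMinus : Subset n → Set
  DisconnectedMinus S = Σ (Fin n) λ u → Σ (Fin n) λ v →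
    u ∉ S × v ∉ S × ¬ Reach S u v

  VertexCut : Subset n → Set
  VertexCut S = DisconnectedMinus S

  KConnected : ℕ → Set
  KConnected k = k < n × (∀ (S : Subset n) → ∣ S ∣ < k → ConnectedMinus S)

  Independent : Subset n → Set
  Independent S = ∀ u v → u ∈ S → v ∈ S → adj G u v ≡ false

  IndependenceNumber> : ℕ → Set
  IndependenceNumber> k = Σ (Subset n) λ S → Independent S × k < ∣ S ∣

  IndepKSetsAreCuts : ℕ → Set
  IndepKSetsAreCuts k = ∀ (S : Subset n) → Independent S → ∣ S ∣ ≡ k → VertexCut S

  Conditions : ℕ → Set
  Conditions k = KConnected k × IndependenceNumber> k × IndepKSetsAreCuts k

record _≅_ {n m : ℕ} (G : Graph n) (H : Graph m) : Set where
  field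
    bij : Fin n ↔ Fin m
    preserves : ∀ u v → adj H (Inverse.to bij u) (Inverse.to bij v) ≡ adj G u v

-- K_{s,s} − PM on vertex set Fin (s + s): vertices i < s form one side,
-- the others the second side; position a on side 1 is matched with
-- position a on side 2, and those matching edges are removed.
neqB : ∀ {s} → Fin s → Fin s → Bool
neqB a b with a ≟ b
... | yes _ = false
... | no _  = true

neqB-sym : ∀ {s} (a b : Fin s) → neqB a b ≡ neqB b a
neqB-sym a b with a ≟ b | b ≟ a
... | yes _ | yes _ = refl
... | no _  | no _  = refl
... | yes refl | no q = Data.Empty.⊥-elim (q refl)
  where import Data.Empty
... | no q | yes refl = Data.Empty.⊥-elim (q refl)
  where import Data.Empty

kpmAdj′ : ∀ {s} → Fin s ⊎ Fin s → Fin s ⊎ Fin s → Bool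
kpmAdj′ (inj₁ a) (inj₂ b) = neqB a b
kpmAdj′ (inj₂ a) (inj₁ b) = neqB a b
kpmAdj′ (inj₁ _) (inj₁ _) = false
kpmAdj′ (inj₂ _) (inj₂ _) = false

kpmAdj′-sym : ∀ {s} (x y : Fin s ⊎ Fin s) → kpmAdj′ x y ≡ kpmAdj′ y x
kpmAdj′-sym (inj₁ a) (inj₂ b) = neqB-sym a b
kpmAdj′-sym (inj₂ a) (inj₁ b) = neqB-sym a b
kpmAdj′-sym (inj₁ _) (inj₁ _) = refl
kpmAdj′-sym (inj₂ _) (inj₂ _) = refl

kpmAdj′-irrefl : ∀ {s} (x : Fin s ⊎ Fin s) → kpmAdj′ x x ≡ false
kpmAdj′-irrefl (inj₁ _) = refl
kpmAdj′-irrefl (inj₂ _) = refl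

KssMinusPM : (s : ℕ) → Graph (s + s)
KssMinusPM s = record
  { adj = λ u v → kpmAdj′ (splitAt s u) (splitAt s v)
  ; sym = λ u v → kpmAdj′-sym (splitAt s u) (splitAt s v)
  ; irrefl = λ u → kpmAdj′-irrefl (splitAt s u)
  }

{-# OPTIONS --safe #-}

-- In K_{k+1,k+1} − PM, deleting fewer than k vertices spares both copies of some index c, and every
-- remaining vertex is joined to the right copy of c; an independent k-set lies within one side, and then
-- the vertex matched with the one surviving vertex of that side is isolated.
--
-- For uniqueness fix an independent set I = {x₀, …, x_k}. Each I − xᵢ is an independent k-set, hence a
-- cut, so some yᵢ ∉ I is separated from xᵢ by I − xᵢ. By k-connectivity the component Cᵢ of yᵢ in G − I
-- is adjacent to every xⱼ with j ≠ i, so the Cᵢ are pairwise distinct. Hence {yⱼ | j ≠ i} is an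
-- independent k-set; if a neighbour of xᵢ avoided it, G minus this set would still be connected, so all
-- neighbours of xᵢ are among the yⱼ. Since any vertex of Cᵢ may serve as yᵢ, each Cᵢ is {yᵢ}, every
-- vertex outside I is some yᵢ, and xᵢ ↦ left i, yᵢ ↦ right i is an isomorphism onto K_{k+1,k+1} − PM.
-- Reachability in a finite graph is decidable, so all choices above are constructive.
module Submission where

open import Data.Bool using (true; false)
import Data.Bool.Properties as Bool
open import Data.Empty using (⊥; ⊥-elim)
open import Data.Fin using (Fin; zero; suc; _↑ˡ_; _↑ʳ_; splitAt; join; punchIn; punchOut; inject≤; fromℕ<)
open import Data.Fin.Properties
  using ( any?; inject≤-injective; punchInᵢ≢i
        ; splitAt-↑ˡ; splitAt-↑ʳ; splitAt⁻¹-↑ˡ; splitAt⁻¹-↑ʳ; splitAt-join; +↔⊎)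
import Data.Fin.Properties as Fin
open import Data.Fin.Subset renaming (⊥ to ∅)
open import Data.Fin.Subset.Induction using (Acc; acc; ⊃-wellFounded)
open import Data.Fin.Subset.Properties
open import Data.Nat using (ℕ; zero; suc; _+_; _∸_; _≤_; _<_; z≤n; s≤s)
open import Data.Nat.Properties
  using ( ≤-trans; ≤-reflexive; ≤-<-trans; +-comm; +-suc; +-identityʳ; +-mono-≤
        ; m≤m+n; m≤n+m; n≤1+n; m+n≤o⇒m≤o; m<n⇒0<n∸m; m+n∸n≡m; suc-injective)
open import Data.Product using (Σ; ∃; _×_; _,_; proj₁; proj₂; map₂)
open import Data.Sum using (_⊎_; inj₁; inj₂; [_,_]′)
open import Data.Vec using (_∷_; []; here; there; _++_)
import Data.Vec as Vec
open import Data.Vec.Functional using (updateAt)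
open import Data.Vec.Functional.Properties using (updateAt-updates; updateAt-minimal)
open import Data.Vec.Properties using (lookup-++ˡ; lookup-++ʳ; []=⇒lookup; lookup⇒[]=)
open import Function using (_∘_; const)
open import Function.Bundles using (_↔_; Inverse; mk⤖)
open import Function.Consequences.Propositional using (strictlySurjective⇒surjective)
open import Function.Definitions using (Injective; StrictlySurjective)
open import Function.Properties.Bijection using (⤖⇒↔)
open import Function.Properties.Inverse using (↔-sym; ↔-trans)
open import Relation.Binary.PropositionalEquality
open import Relation.Nullary using (¬_; yes; no; contradiction)
open import Relation.Nullary.Decidable using (Dec; map′; _×-dec_)

open import Defs hiding (sym)

private variable n m : ℕ

x∉p-x : ∀ {p : Subset n} {x} → x ∉ p - x
x∉p-x {p = _ ∷ p} {zero}  ()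
x∉p-x {p = _ ∷ p} {suc x} (there x∈) = x∉p-x {p = p} x∈

x∉p∪q : ∀ {p q : Subset n} {x} → x ∉ p → x ∉ q → x ∉ p ∪ q
x∉p∪q {p = p} {q} x∉p x∉q x∈ with x∈p∪q⁻ p q x∈
... | inj₁ x∈p = x∉p x∈p
... | inj₂ x∈q = x∉q x∈q

∉⁅x⁆∪⁅y⁆ : ∀ {x y z : Fin n} → z ≢ x → z ≢ y → z ∉ ⁅ x ⁆ ∪ ⁅ y ⁆
∉⁅x⁆∪⁅y⁆ z≢x z≢y = x∉p∪q (x≢y⇒x∉⁅y⁆ z≢x) (x≢y⇒x∉⁅y⁆ z≢y)

∉p∪⁅x⁆ : ∀ {p : Subset n} {x y} → y ∉ p ∪ ⁅ x ⁆ → y ∉ p × y ≢ x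
∉p∪⁅x⁆ {p = p} {x} y∉ = y∉ ∘ p⊆p∪q ⁅ x ⁆ , λ { refl → y∉ (q⊆p∪q p ⁅ x ⁆ (x∈⁅x⁆ x)) }

x∉p∧y∈p⇒x≢y : ∀ {p : Subset n} {x y} → x ∉ p → y ∈ p → x ≢ y
x∉p∧y∈p⇒x≢y x∉p y∈p refl = x∉p y∈p

∣p∣≡1+∣p-x∣ : ∀ {p : Subset n} {x} → x ∈ p → ∣ p ∣ ≡ suc ∣ p - x ∣
∣p∣≡1+∣p-x∣ {p = inside ∷ p}  here      = cong (λ q → suc ∣ q ∣) (sym (p─⊥≡p p))
∣p∣≡1+∣p-x∣ {p = inside ∷ p}  (there x∈p) = cong suc (∣p∣≡1+∣p-x∣ x∈p)
∣p∣≡1+∣p-x∣ {p = outside ∷ p} (there x∈p) = ∣p∣≡1+∣p-x∣ x∈p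

∈⇒∣p∣≢0 : ∀ {p : Subset n} {x} → x ∈ p → ∣ p ∣ ≢ 0
∈⇒∣p∣≢0 x∈p ∣p∣≡0 with () ← trans (sym (∣p∣≡1+∣p-x∣ x∈p)) ∣p∣≡0

Empty⇒∣p∣≡0 : ∀ {p : Subset n} → Empty p → ∣ p ∣ ≡ 0
Empty⇒∣p∣≡0 {n} p-empty = trans (cong ∣_∣ (Empty-unique p-empty)) (∣⊥∣≡0 n)

∣p∣≤1 : ∀ {p : Subset n} {a} → (∀ {x} → x ∈ p → x ≡ a) → ∣ p ∣ ≤ 1
∣p∣≤1 {a = a} only-a =
  ≤-trans (p⊆q⇒∣p∣≤∣q∣ λ x∈p → subst (_∈ ⁅ a ⁆) (sym (only-a x∈p)) (x∈⁅x⁆ a)) (≤-reflexive (∣⁅x⁆∣≡1 a))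

∣p∣≡1⇒singleton : ∀ {p : Subset n} → ∣ p ∣ ≡ 1 → ∃ λ a → a ∈ p × ∀ {x} → x ∈ p → x ≡ a
∣p∣≡1⇒singleton {p = inside ∷ p} ∣p∣≡1 = zero , here , λ
  { here → refl
  ; (there x∈p) → contradiction (suc-injective ∣p∣≡1) (∈⇒∣p∣≢0 x∈p) }
∣p∣≡1⇒singleton {p = outside ∷ p} ∣p∣≡1 with ∣p∣≡1⇒singleton ∣p∣≡1
... | a , a∈p , unique = suc a , there a∈p , λ { (there x∈p) → cong suc (unique x∈p) }

∣p∪q∣≤∣p∣+∣q∣ : ∀ (p q : Subset n) → ∣ p ∪ q ∣ ≤ ∣ p ∣ + ∣ q ∣
∣p∪q∣≤∣p∣+∣q∣ []            []            = z≤n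
∣p∪q∣≤∣p∣+∣q∣ (inside ∷ p)  (inside ∷ q)  =
  s≤s (≤-trans (≤-trans (∣p∪q∣≤∣p∣+∣q∣ p q) (m≤n+m _ 1))
               (≤-reflexive (sym (+-suc ∣ p ∣ ∣ q ∣))))
∣p∪q∣≤∣p∣+∣q∣ (inside ∷ p)  (outside ∷ q) = s≤s (∣p∪q∣≤∣p∣+∣q∣ p q)
∣p∪q∣≤∣p∣+∣q∣ (outside ∷ p) (inside ∷ q)  =
  ≤-trans (s≤s (∣p∪q∣≤∣p∣+∣q∣ p q)) (≤-reflexive (sym (+-suc ∣ p ∣ ∣ q ∣)))
∣p∪q∣≤∣p∣+∣q∣ (outside ∷ p) (outside ∷ q) = ∣p∪q∣≤∣p∣+∣q∣ p q

∣p∪⁅x⁆∣≤1+∣p∣ : ∀ (p : Subset n) x → ∣ p ∪ ⁅ x ⁆ ∣ ≤ suc ∣ p ∣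
∣p∪⁅x⁆∣≤1+∣p∣ p x = ≤-trans (∣p∪q∣≤∣p∣+∣q∣ p ⁅ x ⁆)
  (≤-reflexive (trans (cong (∣ p ∣ +_) (∣⁅x⁆∣≡1 x)) (+-comm ∣ p ∣ 1)))

∣⁅x⁆∪⁅y⁆∣≤2 : ∀ (x y : Fin n) → ∣ ⁅ x ⁆ ∪ ⁅ y ⁆ ∣ ≤ 2
∣⁅x⁆∪⁅y⁆∣≤2 x y = ≤-trans (∣p∪⁅x⁆∣≤1+∣p∣ ⁅ x ⁆ y) (s≤s (≤-reflexive (∣⁅x⁆∣≡1 x)))

∣⁅x⁆∪p∣≡1+∣p∣ : ∀ {x} {p : Subset n} → x ∉ p → ∣ ⁅ x ⁆ ∪ p ∣ ≡ suc ∣ p ∣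
∣⁅x⁆∪p∣≡1+∣p∣ {x = zero}  {outside ∷ p} _   = cong (λ q → suc ∣ q ∣) (∪-identityˡ p)
∣⁅x⁆∪p∣≡1+∣p∣ {x = zero}  {inside ∷ p}  x∉p = contradiction here x∉p
∣⁅x⁆∪p∣≡1+∣p∣ {x = suc x} {outside ∷ p} x∉p = ∣⁅x⁆∪p∣≡1+∣p∣ (x∉p ∘ there)
∣⁅x⁆∪p∣≡1+∣p∣ {x = suc x} {inside ∷ p}  x∉p = cong suc (∣⁅x⁆∪p∣≡1+∣p∣ (x∉p ∘ there))

∣p++q∣≡∣p∣+∣q∣ : ∀ (p : Subset m) (q : Subset n) → ∣ p ++ q ∣ ≡ ∣ p ∣ + ∣ q ∣
∣p++q∣≡∣p∣+∣q∣ []            q = refl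
∣p++q∣≡∣p∣+∣q∣ (inside ∷ p)  q = cong suc (∣p++q∣≡∣p∣+∣q∣ p q)
∣p++q∣≡∣p∣+∣q∣ (outside ∷ p) q = ∣p++q∣≡∣p∣+∣q∣ p q

nonempty : ∀ (p : Subset n) → 0 < ∣ p ∣ → Nonempty p
nonempty {n} p 0<∣p∣ with nonempty? p
... | yes ne = ne
... | no ¬ne with () ← subst (0 <_) (trans (cong ∣_∣ (Empty-unique ¬ne)) (∣⊥∣≡0 n)) 0<∣p∣

fresh : ∀ (p : Subset n) → ∣ p ∣ < n → ∃ λ x → x ∉ p
fresh {n} p ∣p∣<n with nonempty (∁ p) (subst (0 <_) (sym (∣∁p∣≡n∸∣p∣ p)) (m<n⇒0<n∸m ∣p∣<n))
... | x , x∈∁p = x , x∈∁p⇒x∉p x∈∁p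

fresh-≢ : ∀ (p : Subset n) x → suc ∣ p ∣ < n → ∃ λ z → z ∉ p × z ≢ x
fresh-≢ p x 1+∣p∣<n =
  map₂ ∉p∪⁅x⁆ (fresh (p ∪ ⁅ x ⁆) (≤-<-trans (∣p∪⁅x⁆∣≤1+∣p∣ p x) 1+∣p∣<n))

fresh-≢≢ : ∀ (p : Subset n) x y → 2 + ∣ p ∣ < n → ∃ λ z → z ∉ p × z ≢ x × z ≢ y
fresh-≢≢ p x y 2+∣p∣<n
  with fresh-≢ (p ∪ ⁅ x ⁆) y (≤-<-trans (s≤s (∣p∪⁅x⁆∣≤1+∣p∣ p x)) 2+∣p∣<n)
... | z , z∉ , z≢y = z , proj₁ (∉p∪⁅x⁆ z∉) , proj₂ (∉p∪⁅x⁆ z∉) , z≢y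

∈-++⁺ˡ : ∀ {p : Subset m} (q : Subset n) {x} → x ∈ p → x ↑ˡ n ∈ p ++ q
∈-++⁺ˡ {p = p} q {x} x∈p = lookup⇒[]= (x ↑ˡ _) (p ++ q) (trans (lookup-++ˡ p q x) ([]=⇒lookup x∈p))

∈-++⁻ˡ : ∀ (p : Subset m) {q : Subset n} {x} → x ↑ˡ n ∈ p ++ q → x ∈ p
∈-++⁻ˡ p {q} {x} x∈ = lookup⇒[]= x p (trans (sym (lookup-++ˡ p q x)) ([]=⇒lookup x∈))

∈-++⁺ʳ : ∀ (p : Subset m) {q : Subset n} {x} → x ∈ q → m ↑ʳ x ∈ p ++ q
∈-++⁺ʳ {m} p {q} {x} x∈q = lookup⇒[]= (m ↑ʳ x) (p ++ q) (trans (lookup-++ʳ p q x) ([]=⇒lookup x∈q))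

∈-++⁻ʳ : ∀ (p : Subset m) {q : Subset n} {x} → m ↑ʳ x ∈ p ++ q → x ∈ q
∈-++⁻ʳ p {q} {x} x∈ = lookup⇒[]= x q (trans (sym (lookup-++ʳ p q x)) ([]=⇒lookup x∈))

imageOf : (Fin m → Fin n) → Subset n
imageOf {zero}  g = ∅
imageOf {suc m} g = ⁅ g zero ⁆ ∪ imageOf (g ∘ suc)

∈-imageOf⁺ : ∀ (g : Fin m → Fin n) i → g i ∈ imageOf g
∈-imageOf⁺ g zero    = x∈p∪q⁺ (inj₁ (x∈⁅x⁆ (g zero)))
∈-imageOf⁺ g (suc i) = x∈p∪q⁺ (inj₂ (∈-imageOf⁺ (g ∘ suc) i))

∈-imageOf⁻ : ∀ {m} (g : Fin m → Fin n) {v} → v ∈ imageOf g → ∃ λ i → g i ≡ v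
∈-imageOf⁻ {m = zero}  g v∈ = contradiction v∈ ∉⊥
∈-imageOf⁻ {m = suc m} g v∈ with x∈p∪q⁻ ⁅ g zero ⁆ (imageOf (g ∘ suc)) v∈
... | inj₁ v∈⁅g0⁆ = zero , sym (x∈⁅y⁆⇒x≡y _ v∈⁅g0⁆)
... | inj₂ v∈img with ∈-imageOf⁻ (g ∘ suc) v∈img
...   | i , gi≡v = suc i , gi≡v

∣imageOf∣ : ∀ {m} (g : Fin m → Fin n) → Injective _≡_ _≡_ g → ∣ imageOf g ∣ ≡ m
∣imageOf∣ {n} {zero}  g _     = ∣⊥∣≡0 n
∣imageOf∣ {n} {suc m} g g-inj = begin
  ∣ ⁅ g zero ⁆ ∪ imageOf (g ∘ suc) ∣ ≡⟨ ∣⁅x⁆∪p∣≡1+∣p∣ g0∉ ⟩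
  suc ∣ imageOf (g ∘ suc) ∣          ≡⟨ cong suc (∣imageOf∣ (g ∘ suc) (Fin.suc-injective ∘ g-inj)) ⟩
  suc m                              ∎
  where
  open ≡-Reasoning
  g0∉ : g zero ∉ imageOf (g ∘ suc)
  g0∉ g0∈ with ∈-imageOf⁻ (g ∘ suc) g0∈
  ... | i , gi≡g0 with () ← g-inj gi≡g0

enumerate : ∀ (p : Subset n) → Σ (Fin ∣ p ∣ → Fin n) λ e → Injective _≡_ _≡_ e × ∀ i → e i ∈ p
enumerate []            = (λ ()) , (λ {}) , λ ()
enumerate (outside ∷ p) with enumerate p
... | e , e-inj , e∈p = suc ∘ e , e-inj ∘ Fin.suc-injective , there ∘ e∈p
enumerate (inside ∷ p) with enumerate p
... | e , e-inj , e∈p = e′ , e′-inj , e′∈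
  where
  e′ : Fin (suc ∣ p ∣) → Fin _
  e′ zero    = zero
  e′ (suc i) = suc (e i)
  e′-inj : Injective _≡_ _≡_ e′
  e′-inj {zero}  {zero}  _  = refl
  e′-inj {suc i} {suc j} eq = cong suc (e-inj (Fin.suc-injective eq))
  e′∈ : ∀ i → e′ i ∈ inside ∷ p
  e′∈ zero    = here
  e′∈ (suc i) = there (e∈p i)

module Walks {n} (G : Graph n) where

  reach-start∉ : ∀ {S u v} → Reach G S u v → u ∉ S
  reach-start∉ (here u∉S)     = u∉S
  reach-start∉ (step u∉S _ _) = u∉S

  reach-end∉ : ∀ {S u v} → Reach G S u v → v ∉ S
  reach-end∉ (here v∉S)   = v∉S
  reach-end∉ (step _ _ r) = reach-end∉ r

  reach-trans : ∀ {S u v w} → Reach G S u v → Reach G S v w → Reach G S u w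
  reach-trans (here _)         r′ = r′
  reach-trans (step u∉S uw r) r′ = step u∉S uw (reach-trans r r′)

  reach-edge : ∀ {S u v} → u ∉ S → v ∉ S → adj G u v ≡ true → Reach G S u v
  reach-edge u∉S v∉S uv = step u∉S uv (here v∉S)

  reach-snoc : ∀ {S u v w} → Reach G S u v → w ∉ S → adj G v w ≡ true → Reach G S u w
  reach-snoc r w∉S vw = reach-trans r (reach-edge (reach-end∉ r) w∉S vw)

  reach-sym : ∀ {S u v} → Reach G S u v → Reach G S v u
  reach-sym (here u∉S)       = here u∉S
  reach-sym (step u∉S uw r) = reach-snoc (reach-sym r) u∉S (trans (Graph.sym G _ _) uw)

  reach-⊆ : ∀ {S T u v} → T ⊆ S → Reach G S u v → Reach G T u v
  reach-⊆ T⊆S (here u∉S)      = here (u∉S ∘ T⊆S)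
  reach-⊆ T⊆S (step u∉S uw r) = step (u∉S ∘ T⊆S) uw (reach-⊆ T⊆S r)

  reach-confined : ∀ {S T u v} → (∀ {w} → Reach G S u w → w ∉ T) → Reach G S u v → Reach G T u v
  reach-confined avoid (here u∉S)      = here (avoid (here u∉S))
  reach-confined avoid (step u∉S uw r) =
    step (avoid (here u∉S)) uw (reach-confined (avoid ∘ step u∉S uw) r)

  reach-exit : ∀ {S u v} (P : Fin n → Set) {E : Set} →
    (∀ {w x} → P w → adj G w x ≡ true → x ∉ S → P x ⊎ E) →
    Reach G S u v → P u → P v ⊎ E
  reach-exit P step-P (here _)       Pu = inj₁ Pu
  reach-exit P step-P (step _ uw r) Pu with step-P Pu uw (reach-start∉ r)
  ... | inj₁ Pw = reach-exit P step-P r Pw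
  ... | inj₂ e  = inj₂ e

  reach-isolated : ∀ {S u v} → (∀ {w} → adj G u w ≡ true → w ∈ S) → Reach G S u v → u ≡ v
  reach-isolated _         (here _)      = refl
  reach-isolated isolated (step _ uw r) = contradiction (isolated uw) (reach-start∉ r)

  isolated⇒cut : ∀ {S u v} → u ∉ S → v ∉ S → u ≢ v →
    (∀ {w} → adj G u w ≡ true → w ∈ S) → VertexCut G S
  isolated⇒cut u∉S v∉S u≢v isolated = _ , _ , u∉S , v∉S , u≢v ∘ reach-isolated isolated

  private
    u∈S∪⁅u⁆ : ∀ (S : Subset n) u → u ∈ S ∪ ⁅ u ⁆
    u∈S∪⁅u⁆ S u = x∈p∪q⁺ (inj₂ (x∈⁅x⁆ u))

    FirstStep : Subset n → Fin n → Fin n → Set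
    FirstStep S u v = ∃ λ w → adj G u w ≡ true × Reach G (S ∪ ⁅ u ⁆) w v

    -- The part of a walk after its last visit to u avoids u.
    avoid-or-through : ∀ {S u x v} → u ≢ v → Reach G S x v →
      Reach G (S ∪ ⁅ u ⁆) x v ⊎ FirstStep S u v
    avoid-or-through {u = u} {x} u≢v (here x∉S) with x Fin.≟ u
    ... | yes refl = contradiction refl u≢v
    ... | no x≢u   = inj₁ (here (x∉p∪q x∉S (x≢y⇒x∉⁅y⁆ x≢u)))
    avoid-or-through {u = u} {x} u≢v (step x∉S xw r) with avoid-or-through u≢v r | x Fin.≟ u
    ... | inj₂ through | _        = inj₂ through
    ... | inj₁ avoid   | yes refl = inj₂ (_ , xw , avoid)
    ... | inj₁ avoid   | no x≢u   = inj₁ (step (x∉p∪q x∉S (x≢y⇒x∉⁅y⁆ x≢u)) xw avoid)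

    first-step : ∀ {S u v} → u ≢ v → Reach G S u v → FirstStep S u v
    first-step {S} {u} u≢v r with avoid-or-through u≢v r
    ... | inj₁ avoid   = contradiction (u∈S∪⁅u⁆ S u) (reach-start∉ avoid)
    ... | inj₂ through = through

    reach?-acc : ∀ S → Acc _⊃_ S → ∀ u v → Dec (Reach G S u v)
    reach?-acc S (acc rec) u v with u ∈? S | u Fin.≟ v
    ... | yes u∈S | _        = no λ r → reach-start∉ r u∈S
    ... | no u∉S  | yes refl = yes (here u∉S)
    ... | no u∉S  | no u≢v   = map′
      (λ { (w , uw , r) → step u∉S uw (reach-⊆ (p⊆p∪q ⁅ u ⁆) r) })
      (first-step u≢v)
      (any? λ w → (adj G u w Bool.≟ true) ×-dec reach?-acc (S ∪ ⁅ u ⁆) (rec S⊂S∪⁅u⁆) w v)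
      where
      S⊂S∪⁅u⁆ : S ⊂ S ∪ ⁅ u ⁆
      S⊂S∪⁅u⁆ = p⊆p∪q ⁅ u ⁆ , u , u∈S∪⁅u⁆ S u , u∉S

  reach? : ∀ S u v → Dec (Reach G S u v)
  reach? S = reach?-acc S (⊃-wellFounded S)

neqB-refl : ∀ {s} (a : Fin s) → neqB a a ≡ false
neqB-refl a with a Fin.≟ a
... | yes _  = refl
... | no a≢a = contradiction refl a≢a

neqB-≢ : ∀ {s} {a b : Fin s} → a ≢ b → neqB a b ≡ true
neqB-≢ {a = a} {b} a≢b with a Fin.≟ b
... | yes a≡b = contradiction a≡b a≢b
... | no _    = refl

neqB≡false⇒≡ : ∀ {s} {a b : Fin s} → neqB a b ≡ false → a ≡ b
neqB≡false⇒≡ {a = a} {b} eq with a Fin.≟ b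
... | yes a≡b = a≡b

module Crown (k : ℕ) where

  s : ℕ
  s = suc k

  H : Graph (s + s)
  H = KssMinusPM s

  open Walks H

  left right : Fin s → Fin (s + s)
  left a  = a ↑ˡ s
  right b = s ↑ʳ b

  adj-left-right : ∀ a b → adj H (left a) (right b) ≡ neqB a b
  adj-left-right a b rewrite splitAt-↑ˡ s a s | splitAt-↑ʳ s s b = refl

  adj-right-left : ∀ a b → adj H (right a) (left b) ≡ neqB a b
  adj-right-left a b rewrite splitAt-↑ˡ s b s | splitAt-↑ʳ s s a = refl

  adj-left-left : ∀ a b → adj H (left a) (left b) ≡ false
  adj-left-left a b rewrite splitAt-↑ˡ s a s | splitAt-↑ˡ s b s = refl

  adj-right-right : ∀ a b → adj H (right a) (right b) ≡ false
  adj-right-right a b rewrite splitAt-↑ʳ s s a | splitAt-↑ʳ s s b = refl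

  data Position : Fin (s + s) → Set where
    on-left  : ∀ a → Position (left a)
    on-right : ∀ b → Position (right b)

  position : ∀ u → Position u
  position u with splitAt s u in eq
  ... | inj₁ a = subst Position (splitAt⁻¹-↑ˡ eq) (on-left a)
  ... | inj₂ b = subst Position (splitAt⁻¹-↑ʳ eq) (on-right b)

  left≢right : ∀ a b → left a ≢ right b
  left≢right a b eq
    with () ← trans (sym (splitAt-↑ˡ s a s)) (trans (cong (splitAt s) eq) (splitAt-↑ʳ s s b))

  leftSide : Subset (s + s)
  leftSide = ⊤ {s} ++ ∅ {s}

  crown-independence : IndependenceNumber> H k
  crown-independence = leftSide , independent , ≤-reflexive (sym ∣leftSide∣≡s)
    where
    ∣leftSide∣≡s : ∣ leftSide ∣ ≡ s
    ∣leftSide∣≡s = begin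
      ∣ ⊤ {s} ++ ∅ {s} ∣    ≡⟨ ∣p++q∣≡∣p∣+∣q∣ (⊤ {s}) (∅ {s}) ⟩
      ∣ ⊤ {s} ∣ + ∣ ∅ {s} ∣ ≡⟨ cong₂ _+_ (∣⊤∣≡n s) (∣⊥∣≡0 s) ⟩
      s + 0                 ≡⟨ +-identityʳ s ⟩
      s                     ∎
      where open ≡-Reasoning
    left-only : ∀ {u} → u ∈ leftSide → ∃ λ a → left a ≡ u
    left-only {u} u∈ with position u
    ... | on-left a  = a , refl
    ... | on-right b = contradiction (∈-++⁻ʳ (⊤ {s}) u∈) ∉⊥
    independent : Independent H leftSide
    independent u v u∈ v∈ with left-only u∈ | left-only v∈
    ... | a , refl | b , refl = adj-left-left a b

  private
    one-small-side : ∀ m₁ m₂ → m₁ + m₂ < k → 2 ≤ k → 2 + m₁ ≤ k ⊎ 2 + m₂ ≤ k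
    one-small-side m₁ zero     _      2≤k = inj₂ 2≤k
    one-small-side m₁ (suc m₂) m₁+m₂<k _  =
      inj₁ (≤-trans (s≤s (≤-trans (s≤s (m≤m+n m₁ m₂)) (≤-reflexive (sym (+-suc m₁ m₂))))) m₁+m₂<k)

  crown-connected : 2 ≤ k → KConnected H k
  crown-connected 2≤k = m≤m+n s s , connected
    where
    connected : ∀ S → ∣ S ∣ < k → ConnectedMinus H S
    connected S ∣S∣<k with Vec.splitAt s S
    ... | S₁ , S₂ , refl = λ u v u∉ v∉ → reach-trans (to-hub u∉) (reach-sym (to-hub v∉))
      where
      sizes : ∣ S₁ ∣ + ∣ S₂ ∣ < k
      sizes = subst (_< k) (∣p++q∣≡∣p∣+∣q∣ S₁ S₂) ∣S∣<k

      ∣S₁∣<k : ∣ S₁ ∣ < k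
      ∣S₁∣<k = m+n≤o⇒m≤o (suc ∣ S₁ ∣) sizes

      ∣S₂∣<k : ∣ S₂ ∣ < k
      ∣S₂∣<k = ≤-trans (s≤s (m≤n+m ∣ S₂ ∣ ∣ S₁ ∣)) sizes

      left∉ : ∀ {a} → a ∉ S₁ → left a ∉ S
      left∉ a∉ = a∉ ∘ ∈-++⁻ˡ S₁

      right∉ : ∀ {b} → b ∉ S₂ → right b ∉ S
      right∉ b∉ = b∉ ∘ ∈-++⁻ʳ S₁

      edge-left-right : ∀ {a b} → a ∉ S₁ → b ∉ S₂ → a ≢ b → Reach H S (left a) (right b)
      edge-left-right {a} {b} a∉ b∉ a≢b =
        reach-edge (left∉ a∉) (right∉ b∉) (trans (adj-left-right a b) (neqB-≢ a≢b))

      edge-right-left : ∀ {a b} → a ∉ S₂ → b ∉ S₁ → a ≢ b → Reach H S (right a) (left b)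
      edge-right-left {a} {b} a∉ b∉ a≢b =
        reach-edge (right∉ a∉) (left∉ b∉) (trans (adj-right-left a b) (neqB-≢ a≢b))

      hub : ∃ λ c → c ∉ S₁ ∪ S₂
      hub = fresh (S₁ ∪ S₂) (≤-<-trans (∣p∪q∣≤∣p∣+∣q∣ S₁ S₂) (≤-trans sizes (n≤1+n k)))

      c : Fin s
      c = proj₁ hub

      c∉S₁ : c ∉ S₁
      c∉S₁ = proj₂ hub ∘ p⊆p∪q S₂

      c∉S₂ : c ∉ S₂
      c∉S₂ = proj₂ hub ∘ q⊆p∪q S₁ S₂

      bridge-via : ∀ {a b} → a ∉ S₂ → b ∉ S₁ → a ≢ c → b ≢ c → a ≢ b → Reach H S (left c) (right c)
      bridge-via a∉ b∉ a≢c b≢c a≢b =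
        reach-trans (edge-left-right c∉S₁ a∉ (a≢c ∘ sym))
          (reach-trans (edge-right-left a∉ b∉ a≢b) (edge-left-right b∉ c∉S₂ b≢c))

      bridge : Reach H S (left c) (right c)
      bridge with one-small-side ∣ S₁ ∣ ∣ S₂ ∣ sizes 2≤k
      ... | inj₁ 2+∣S₁∣≤k with fresh-≢ S₂ c (s≤s ∣S₂∣<k)
      ...   | a , a∉S₂ , a≢c with fresh-≢≢ S₁ c a (s≤s 2+∣S₁∣≤k)
      ...     | b , b∉S₁ , b≢c , b≢a = bridge-via a∉S₂ b∉S₁ a≢c b≢c (b≢a ∘ sym)
      bridge | inj₂ 2+∣S₂∣≤k with fresh-≢ S₁ c (s≤s ∣S₁∣<k)
      ...   | b , b∉S₁ , b≢c with fresh-≢≢ S₂ c b (s≤s 2+∣S₂∣≤k)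
      ...     | a , a∉S₂ , a≢c , a≢b = bridge-via a∉S₂ b∉S₁ a≢c b≢c a≢b

      to-hub : ∀ {u} → u ∉ S → Reach H S u (right c)
      to-hub {u} u∉ with position u
      ... | on-left x with x Fin.≟ c
      ...   | yes refl = bridge
      ...   | no x≢c   = edge-left-right (u∉ ∘ ∈-++⁺ˡ S₂) c∉S₂ x≢c
      to-hub {u} u∉ | on-right x with x Fin.≟ c
      ...   | yes refl = here u∉
      ...   | no x≢c   = reach-trans (edge-right-left (u∉ ∘ ∈-++⁺ʳ S₁) c∉S₁ x≢c) bridge

  private
    lone-survivor : (X : Subset s) → ∣ X ∣ ≡ k → ∃ λ a → a ∉ X × ∀ {x} → x ∉ X → x ≡ a
    lone-survivor X ∣X∣≡k
      with ∣p∣≡1⇒singleton (trans (∣∁p∣≡n∸∣p∣ X) (trans (cong (s ∸_) ∣X∣≡k) (m+n∸n≡m 1 k)))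
    ... | a , a∈∁X , unique = a , x∈∁p⇒x∉p a∈∁X , unique ∘ x∉p⇒x∈∁p

    right-isolated : ∀ {S₁ S₂ : Subset s} → ∣ S₁ ∣ ≡ k → Empty S₂ → VertexCut H (S₁ ++ S₂)
    right-isolated {S₁} {S₂} ∣S₁∣≡k S₂-empty with lone-survivor S₁ ∣S₁∣≡k
    ... | a , a∉S₁ , lone =
      isolated⇒cut (λ a∈ → S₂-empty (a , ∈-++⁻ʳ S₁ a∈)) (a∉S₁ ∘ ∈-++⁻ˡ S₁) (left≢right a a ∘ sym)
        isolated
      where
      isolated : ∀ {w} → adj H (right a) w ≡ true → w ∈ S₁ ++ S₂
      isolated {w} aw with position w
      ... | on-right b = contradiction (trans (sym aw) (adj-right-right a b)) λ ()
      ... | on-left b with b ∈? S₁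
      ...   | yes b∈S₁ = ∈-++⁺ˡ S₂ b∈S₁
      ...   | no b∉S₁ with refl ← lone b∉S₁ =
        contradiction (trans (sym aw) (trans (adj-right-left a a) (neqB-refl a))) λ ()

    left-isolated : ∀ {S₁ S₂ : Subset s} → Empty S₁ → ∣ S₂ ∣ ≡ k → VertexCut H (S₁ ++ S₂)
    left-isolated {S₁} {S₂} S₁-empty ∣S₂∣≡k with lone-survivor S₂ ∣S₂∣≡k
    ... | a , a∉S₂ , lone =
      isolated⇒cut (λ a∈ → S₁-empty (a , ∈-++⁻ˡ S₁ a∈)) (a∉S₂ ∘ ∈-++⁻ʳ S₁) (left≢right a a)
        isolated
      where
      isolated : ∀ {w} → adj H (left a) w ≡ true → w ∈ S₁ ++ S₂
      isolated {w} aw with position w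
      ... | on-left b = contradiction (trans (sym aw) (adj-left-left a b)) λ ()
      ... | on-right b with b ∈? S₂
      ...   | yes b∈S₂ = ∈-++⁺ʳ S₁ b∈S₂
      ...   | no b∉S₂ with refl ← lone b∉S₂ =
        contradiction (trans (sym aw) (trans (adj-left-right a a) (neqB-refl a))) λ ()

  crown-cuts : 3 ≤ k → IndepKSetsAreCuts H k
  crown-cuts 3≤k S independent ∣S∣≡k with Vec.splitAt s S
  ... | S₁ , S₂ , refl = split-cut S₁ S₂ independent (trans (sym (∣p++q∣≡∣p∣+∣q∣ S₁ S₂)) ∣S∣≡k)
    where
    split-cut : ∀ S₁ S₂ → Independent H (S₁ ++ S₂) → ∣ S₁ ∣ + ∣ S₂ ∣ ≡ k →
      VertexCut H (S₁ ++ S₂)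
    split-cut S₁ S₂ independent sizes with nonempty? S₁ | nonempty? S₂
    ... | yes (a , a∈S₁) | yes (b , b∈S₂) = contradiction 3≤2 λ { (s≤s (s≤s ())) }
      where
      matched : ∀ {x y} → x ∈ S₁ → y ∈ S₂ → x ≡ y
      matched {x} {y} x∈S₁ y∈S₂ = neqB≡false⇒≡ (trans (sym (adj-left-right x y))
        (independent (left x) (right y) (∈-++⁺ˡ S₂ x∈S₁) (∈-++⁺ʳ S₁ y∈S₂)))
      3≤2 : 3 ≤ 1 + 1
      3≤2 = ≤-trans 3≤k (≤-trans (≤-reflexive (sym sizes))
        (+-mono-≤ (∣p∣≤1 λ x∈S₁ → matched x∈S₁ b∈S₂)
                  (∣p∣≤1 λ y∈S₂ → sym (matched a∈S₁ y∈S₂))))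
    ... | _ | no S₂-empty = right-isolated ∣S₁∣≡k S₂-empty
      where
      ∣S₁∣≡k : ∣ S₁ ∣ ≡ k
      ∣S₁∣≡k =
        trans (sym (+-identityʳ _)) (trans (cong (∣ S₁ ∣ +_) (sym (Empty⇒∣p∣≡0 S₂-empty))) sizes)
    ... | no S₁-empty | yes _ = left-isolated S₁-empty ∣S₂∣≡k
      where
      ∣S₂∣≡k : ∣ S₂ ∣ ≡ k
      ∣S₂∣≡k = trans (cong (_+ ∣ S₂ ∣) (sym (Empty⇒∣p∣≡0 S₁-empty))) sizes

  crown-≅ : ∀ {n} (G : Graph n) (f : Fin s ⊎ Fin s → Fin n) →
    Injective _≡_ _≡_ f → StrictlySurjective _≡_ f →
    (∀ c d → adj G (f c) (f d) ≡ kpmAdj′ c d) → G ≅ H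
  crown-≅ G f f-inj f-surj f-adj = record { bij = bij ; preserves = preserves }
    where
    F : (Fin s ⊎ Fin s) ↔ Fin _
    F = ⤖⇒↔ (mk⤖ (f-inj , strictlySurjective⇒surjective f-surj))
    open Inverse F using (from; strictlyInverseˡ)
    bij : Fin _ ↔ Fin (s + s)
    bij = ↔-trans (↔-sym F) (↔-sym +↔⊎)
    preserves : ∀ u v → adj H (Inverse.to bij u) (Inverse.to bij v) ≡ adj G u v
    preserves u v = begin
      adj H (join s s (from u)) (join s s (from v))
        ≡⟨ cong₂ kpmAdj′ (splitAt-join s s (from u)) (splitAt-join s s (from v)) ⟩
      kpmAdj′ (from u) (from v)
        ≡⟨ sym (f-adj (from u) (from v)) ⟩
      adj G (f (from u)) (f (from v))
        ≡⟨ cong₂ (adj G) (strictlyInverseˡ u) (strictlyInverseˡ v) ⟩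
      adj G u v
        ∎
      where open ≡-Reasoning

module Uniqueness {n} (G : Graph n) {k} (3≤k : 3 ≤ k)
  (connected : ∀ T → ∣ T ∣ < k → ConnectedMinus G T)
  (cuts : IndepKSetsAreCuts G k)
  (e : Fin (suc k) → Fin n) (e-injective : Injective _≡_ _≡_ e)
  (e-independent : ∀ a b → adj G (e a) (e b) ≡ false)
  where

  open Walks G
  open Graph G using () renaming (sym to adj-sym)

  0<k : 0 < k
  0<k = ≤-trans (s≤s z≤n) 3≤k

  1<k : 1 < k
  1<k = ≤-trans (s≤s (s≤s z≤n)) 3≤k

  I : Subset n
  I = imageOf e

  e∈I : ∀ a → e a ∈ I
  e∈I = ∈-imageOf⁺ e

  ∉I⇒≢e : ∀ {v a} → v ∉ I → v ≢ e a
  ∉I⇒≢e v∉I = x∉p∧y∈p⇒x≢y v∉I (e∈I _)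

  I-independent : Independent G I
  I-independent u v u∈I v∈I with ∈-imageOf⁻ e u∈I | ∈-imageOf⁻ e v∈I
  ... | a , refl | b , refl = e-independent a b

  neighbour∉I : ∀ {u v} → u ∈ I → adj G u v ≡ true → v ∉ I
  neighbour∉I {u} {v} u∈I uv v∈I with () ← trans (sym uv) (I-independent u v u∈I v∈I)

  I-e⊆I : ∀ a → I - e a ⊆ I
  I-e⊆I a = p─q⊆p I ⁅ e a ⁆

  ∣I-e∣≡k : ∀ a → ∣ I - e a ∣ ≡ k
  ∣I-e∣≡k a = suc-injective (trans (sym (∣p∣≡1+∣p-x∣ (e∈I a))) (∣imageOf∣ e e-injective))

  -- The partner of e a will turn out to be the vertex matched with e a in the removed perfect matching.
  Partner : Fin (suc k) → Fin n → Set
  Partner a v = v ∉ I × ¬ Reach G (I - e a) (e a) v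

  separated⇒∉I : ∀ {a v} → v ∉ I - e a → ¬ Reach G (I - e a) (e a) v → v ∉ I
  separated⇒∉I {a} {v} v∉ ¬av v∈I with v Fin.≟ e a
  ... | yes refl = ¬av (here x∉p-x)
  ... | no v≢ea  = v∉ (x∈p∧x≢y⇒x∈p-y v∈I v≢ea)

  partner-exists : ∀ a → ∃ (Partner a)
  partner-exists a
    with cuts (I - e a) (λ u v u∈ v∈ → I-independent u v (I-e⊆I a u∈) (I-e⊆I a v∈)) (∣I-e∣≡k a)
  ... | p , q , p∉ , q∉ , ¬pq with reach? (I - e a) (e a) p
  ...   | no ¬ap = p , separated⇒∉I p∉ ¬ap , ¬ap
  ...   | yes ap = q , separated⇒∉I q∉ ¬aq , ¬aq
    where
    ¬aq : ¬ Reach G (I - e a) (e a) q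
    ¬aq aq = ¬pq (reach-trans (reach-sym ap) aq)

  IsPartnerChoice : (Fin (suc k) → Fin n) → Set
  IsPartnerChoice y = ∀ a → Partner a (y a)

  module PartnerChoice (y : Fin (suc k) → Fin n) (partner : IsPartnerChoice y) where

    y∉I : ∀ a → y a ∉ I
    y∉I a = proj₁ (partner a)

    component-not-adjacent : ∀ {a c} → Reach G I (y a) c → adj G c (e a) ≡ true → ⊥
    component-not-adjacent {a} r ca =
      proj₂ (partner a) (reach-sym (reach-snoc (reach-⊆ (I-e⊆I a) r) x∉p-x ca))

    Touches : Fin (suc k) → Fin (suc k) → Set
    Touches a b = ∃ λ c → Reach G I (y a) c × adj G c (e b) ≡ true

    -- G − (I − e a − e b) is connected, and a walk in it from y a to e a cannot enter I first at e a.
    component-touches : ∀ {a b} → a ≢ b → Touches a b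
    component-touches {a} {b} a≢b
      with reach-exit (Reach G I (y a)) exit-step (connected T ∣T∣<k (y a) (e a) (y∉I a ∘ T⊆I) ea∉T)
                      (here (y∉I a))
      where
      T : Subset n
      T = I - e a - e b
      T⊆I-ea : T ⊆ I - e a
      T⊆I-ea = p─q⊆p (I - e a) ⁅ e b ⁆
      T⊆I : T ⊆ I
      T⊆I = I-e⊆I a ∘ T⊆I-ea
      ea∉T : e a ∉ T
      ea∉T = x∉p-x ∘ T⊆I-ea
      ∣T∣<k : ∣ T ∣ < k
      eb∈I-ea : e b ∈ I - e a
      eb∈I-ea = x∈p∧x≢y⇒x∈p-y (e∈I b) (a≢b ∘ e-injective ∘ sym)
      ∣T∣<k = ≤-reflexive (trans (sym (∣p∣≡1+∣p-x∣ eb∈I-ea)) (∣I-e∣≡k a))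
      exit-step : ∀ {c d} → Reach G I (y a) c → adj G c d ≡ true → d ∉ T → Reach G I (y a) d ⊎ Touches a b
      exit-step {c} {d} r cd d∉T with d ∈? I | d Fin.≟ e a | d Fin.≟ e b
      ... | no d∉I  | _        | _        = inj₁ (reach-snoc r d∉I cd)
      ... | yes _   | yes refl | _        = ⊥-elim (component-not-adjacent r cd)
      ... | yes _   | no _     | yes refl = inj₂ (c , r , cd)
      ... | yes d∈I | no d≢ea  | no d≢eb  =
        ⊥-elim (d∉T (x∈p∧x≢y⇒x∈p-y (x∈p∧x≢y⇒x∈p-y d∈I d≢ea) d≢eb))
    ... | inj₁ r     = ⊥-elim (reach-end∉ r (e∈I a))
    ... | inj₂ touch = touch

    components-disjoint : ∀ {a b} → Reach G I (y a) (y b) → a ≡ b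
    components-disjoint {a} {b} r with a Fin.≟ b
    ... | yes a≡b = a≡b
    ... | no a≢b with component-touches (a≢b ∘ sym)
    ...   | c , r′ , ca = ⊥-elim (component-not-adjacent (reach-trans r r′) ca)

    y-injective : Injective _≡_ _≡_ y
    y-injective {a} {b} ya≡yb = components-disjoint (subst (Reach G I (y a)) ya≡yb (here (y∉I a)))

    partners-independent : ∀ a b → adj G (y a) (y b) ≡ false
    partners-independent a b with adj G (y a) (y b) in ab
    ... | false = refl
    ... | true with refl ← components-disjoint (reach-edge (y∉I a) (y∉I b) ab) =
      trans (sym ab) (Graph.irrefl G (y a))

    partnersExcept : Fin (suc k) → Subset n
    partnersExcept a = imageOf (y ∘ punchIn a)

    ∣partnersExcept∣≡k : ∀ a → ∣ partnersExcept a ∣ ≡ k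
    ∣partnersExcept∣≡k a = ∣imageOf∣ (y ∘ punchIn a) (Fin.punchIn-injective a _ _ ∘ y-injective)

    partnersExcept-independent : ∀ a → Independent G (partnersExcept a)
    partnersExcept-independent a u v u∈ v∈
      with ∈-imageOf⁻ (y ∘ punchIn a) u∈ | ∈-imageOf⁻ (y ∘ punchIn a) v∈
    ... | i , refl | j , refl = partners-independent (punchIn a i) (punchIn a j)

    ∈-partnersExcept⁺ : ∀ {a b} → b ≢ a → y b ∈ partnersExcept a
    ∈-partnersExcept⁺ {a} {b} b≢a = subst (λ c → y c ∈ partnersExcept a) (Fin.punchIn-punchOut (b≢a ∘ sym))
      (∈-imageOf⁺ (y ∘ punchIn a) (punchOut (b≢a ∘ sym)))

    ∈-partnersExcept⁻ : ∀ {a v} → v ∈ partnersExcept a → ∃ λ b → b ≢ a × y b ≡ v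
    ∈-partnersExcept⁻ {a} v∈ with ∈-imageOf⁻ (y ∘ punchIn a) v∈
    ... | i , yi≡v = punchIn a i , punchInᵢ≢i a i , yi≡v

    -- Y is an independent k-set, hence a cut; but if e a₀ had a neighbour outside Y, every vertex of G − Y would
    -- reach h.
    module Neighbourhood (a₀ : Fin (suc k)) where

      h : Fin n
      h = y a₀

      Y : Subset n
      Y = partnersExcept a₀

      I∉Y : ∀ {v} → v ∈ I → v ∉ Y
      I∉Y v∈I v∈Y with ∈-partnersExcept⁻ v∈Y
      ... | b , _ , refl = y∉I b v∈I

      component-avoids-Y : ∀ {c} → Reach G I h c → Reach G Y h c
      component-avoids-Y = reach-confined avoid
        where
        avoid : ∀ {w} → Reach G I h w → w ∉ Y
        avoid r w∈Y with ∈-partnersExcept⁻ w∈Y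
        ... | b , b≢a₀ , refl = b≢a₀ (sym (components-disjoint r))

      I-reaches-h : ∀ {v} → v ∈ I → v ≢ e a₀ → Reach G Y v h
      I-reaches-h v∈I v≢ea₀ with ∈-imageOf⁻ e v∈I
      ... | b , refl with component-touches {a₀} {b} (v≢ea₀ ∘ cong e ∘ sym)
      ...   | c , r , cb = reach-sym (reach-snoc r′ (I∉Y v∈I) cb)
        where
        r′ : Reach G Y h c
        r′ = component-avoids-Y r

      Blocked : Subset n → Fin n → Set
      Blocked T c = ∀ {d b} → Reach G I c d → adj G d (y b) ≡ true → b ≢ a₀ → y b ∉ T → ⊥

      -- A walk from c to h in G − T first meets I ∪ Y either in I − e a₀, which reaches h within G − Y, or in
      -- a partner that Blocked T c excludes.
      exit-to-h : ∀ {c} (T : Subset n) → ∣ T ∣ < k → e a₀ ∈ T → h ∉ T → c ∉ T → c ∉ I → c ∉ Y →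
        Blocked T c → Reach G Y c h
      exit-to-h {c} T ∣T∣<k ea₀∈T h∉T c∉T c∉I c∉Y blocked
        with reach-exit (Reach G (I ∪ Y) c) exit-step (connected T ∣T∣<k c h c∉T h∉T)
                        (here (x∉p∪q c∉I c∉Y))
        where
        exit-step : ∀ {d d′} → Reach G (I ∪ Y) c d → adj G d d′ ≡ true → d′ ∉ T →
          Reach G (I ∪ Y) c d′ ⊎ Reach G Y c h
        exit-step {d} {d′} r dd′ d′∉T with d′ ∈? I | d′ ∈? Y
        ... | yes d′∈I | _ = inj₂ (reach-trans (reach-snoc (reach-⊆ (q⊆p∪q I Y) r) (I∉Y d′∈I) dd′)
                                               (I-reaches-h d′∈I λ { refl → d′∉T ea₀∈T }))
        ... | no _ | yes d′∈Y with ∈-partnersExcept⁻ d′∈Y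
        ...   | b , b≢a₀ , refl = ⊥-elim (blocked (reach-⊆ (p⊆p∪q Y) r) dd′ b≢a₀ d′∉T)
        exit-step {d} {d′} r dd′ d′∉T | no d′∉I | no d′∉Y =
          inj₁ (reach-snoc r (x∉p∪q d′∉I d′∉Y) dd′)
      ... | inj₁ r = reach-⊆ (q⊆p∪q I Y) r
      ... | inj₂ r = r

      -- Take T = {e a₀, y b} if c lies in the component of some y b with b ≢ a₀, and T = {e a₀} otherwise;
      -- either way no partner outside T is adjacent to the component of c, and ∣ T ∣ ≤ 2 < k.
      outside-reaches-h : ∀ {c} → c ∉ I → c ∉ Y → Reach G Y c h
      outside-reaches-h {c} c∉I c∉Y with any? (λ b → reach? I (y b) c)
      ... | yes (b , r) with b Fin.≟ a₀
      ...   | yes refl = reach-sym (component-avoids-Y r)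
      ...   | no b≢a₀  =
        exit-to-h (⁅ e a₀ ⁆ ∪ ⁅ y b ⁆) (≤-<-trans (∣⁅x⁆∪⁅y⁆∣≤2 (e a₀) (y b)) 3≤k) (x∈p∪q⁺ (inj₁ (x∈⁅x⁆ (e a₀))))
          (∉⁅x⁆∪⁅y⁆ (∉I⇒≢e (y∉I a₀)) (b≢a₀ ∘ sym ∘ y-injective))
          (∉⁅x⁆∪⁅y⁆ (∉I⇒≢e c∉I) (x∉p∧y∈p⇒x≢y c∉Y (∈-partnersExcept⁺ b≢a₀)))
          c∉I c∉Y blocked
        where
        blocked : Blocked (⁅ e a₀ ⁆ ∪ ⁅ y b ⁆) c
        blocked {d} {b′} r′ d-yb′ _ yb′∉T
          with refl ← components-disjoint (reach-trans r (reach-snoc r′ (y∉I b′) d-yb′))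
          = yb′∉T (q⊆p∪q ⁅ e a₀ ⁆ ⁅ y b ⁆ (x∈⁅x⁆ (y b)))
      outside-reaches-h {c} c∉I c∉Y | no none =
        exit-to-h ⁅ e a₀ ⁆ (≤-<-trans (≤-reflexive (∣⁅x⁆∣≡1 (e a₀))) 1<k) (x∈⁅x⁆ (e a₀))
          (x≢y⇒x∉⁅y⁆ (∉I⇒≢e (y∉I a₀))) (x≢y⇒x∉⁅y⁆ (∉I⇒≢e c∉I)) c∉I c∉Y blocked
        where
        blocked : Blocked ⁅ e a₀ ⁆ c
        blocked {d} {b′} r d-yb′ _ _ =
          none (b′ , reach-sym (reach-snoc r (y∉I b′) d-yb′))

      reaches-h : ∀ {v c} → adj G (e a₀) v ≡ true → v ∉ Y → c ∉ Y → Reach G Y c h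
      reaches-h {v} {c} a₀v v∉Y c∉Y with c ∈? I | c Fin.≟ e a₀
      ... | no c∉I  | _        = outside-reaches-h c∉I c∉Y
      ... | yes c∈I | no c≢ea₀ = I-reaches-h c∈I c≢ea₀
      ... | yes _   | yes refl =
        reach-trans (reach-edge c∉Y v∉Y a₀v) (outside-reaches-h (neighbour∉I (e∈I a₀) a₀v) v∉Y)

      neighbours⊆Y : ∀ {v} → adj G (e a₀) v ≡ true → v ∈ Y
      neighbours⊆Y {v} a₀v with v ∈? Y
      ... | yes v∈Y = v∈Y
      ... | no v∉Y with cuts Y (partnersExcept-independent a₀) (∣partnersExcept∣≡k a₀)
      ...   | p , q , p∉ , q∉ , ¬pq =
        ⊥-elim (¬pq (reach-trans (reaches-h a₀v v∉Y p∉) (reach-sym (reaches-h a₀v v∉Y q∉))))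

    neighbour-is-partner : ∀ {a v} → adj G (e a) v ≡ true → ∃ λ b → y b ≡ v
    neighbour-is-partner {a} av with ∈-partnersExcept⁻ (Neighbourhood.neighbours⊆Y a av)
    ... | b , _ , yb≡v = b , yb≡v

    neighbour-in-component : ∀ {a b v} → adj G (e a) v ≡ true → Reach G I (y b) v → v ≡ y b
    neighbour-in-component av r with neighbour-is-partner av
    ... | b′ , refl with refl ← components-disjoint r = refl

  partners-update : ∀ {y} → IsPartnerChoice y → ∀ {b c} → Reach G I (y b) c →
    IsPartnerChoice (updateAt y b (const c))
  partners-update {y} partner {b} {c} r a with a Fin.≟ b
  ... | yes refl rewrite updateAt-updates a {const c} y =
    reach-end∉ r , λ r′ → proj₂ (partner a) (reach-trans r′ (reach-sym (reach-⊆ (I-e⊆I a) r)))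
  ... | no a≢b rewrite updateAt-minimal a b {const c} y a≢b = partner a

  -- Moving the partner of e b anywhere inside its component keeps a partner choice, and the neighbour of
  -- another vertex of I in that component is always the chosen partner.
  component-trivial : ∀ {y} → IsPartnerChoice y → ∀ {b c} → Reach G I (y b) c → c ≡ y b
  component-trivial {y} partner {b} {c} r
    with PartnerChoice.component-touches y partner (punchInᵢ≢i b (fromℕ< 0<k) ∘ sym)
  ... | d , rd , da = trans (sym d≡c) d≡yb
    where
    y′ : Fin (suc k) → Fin n
    y′ = updateAt y b (const c)
    d≡yb : d ≡ y b
    d≡yb = PartnerChoice.neighbour-in-component y partner (trans (adj-sym _ _) da) rd
    d≡c : d ≡ c
    d≡c = trans (PartnerChoice.neighbour-in-component y′ (partners-update partner r) (trans (adj-sym _ _) da)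
                  (subst (λ z → Reach G I z d) (sym (updateAt-updates b y)) (reach-trans (reach-sym r) rd)))
                (updateAt-updates b y)

  y : Fin (suc k) → Fin n
  y a = proj₁ (partner-exists a)

  partner : IsPartnerChoice y
  partner a = proj₂ (partner-exists a)

  open PartnerChoice y partner

  partner-adjacency : ∀ a b → adj G (e a) (y b) ≡ neqB a b
  partner-adjacency a b with a Fin.≟ b
  ... | yes refl = Bool.¬-not λ ay → component-not-adjacent (here (y∉I a)) (trans (adj-sym _ _) ay)
  ... | no a≢b with component-touches (a≢b ∘ sym)
  ...   | c , r , ca with refl ← component-trivial partner r = trans (adj-sym _ _) ca

  outside-is-partner : ∀ {v} → v ∉ I → ∃ λ b → y b ≡ v
  outside-is-partner {v} v∉I
    with reach-exit (Reach G I v) exit-step (connected ∅ ∣∅∣<k v (e zero) ∉⊥ ∉⊥) (here v∉I)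
    where
    ∣∅∣<k : ∣ ∅ {n} ∣ < k
    ∣∅∣<k = ≤-<-trans (≤-reflexive (∣⊥∣≡0 n)) 0<k
    exit-step : ∀ {d d′} → Reach G I v d → adj G d d′ ≡ true → d′ ∉ ∅ →
      Reach G I v d′ ⊎ ∃ λ b → y b ≡ v
    exit-step {d} {d′} r dd′ _ with d′ ∈? I
    ... | no d′∉I = inj₁ (reach-snoc r d′∉I dd′)
    ... | yes d′∈I with ∈-imageOf⁻ e d′∈I
    ...   | a , refl with neighbour-is-partner (trans (adj-sym _ _) dd′)
    ...     | b , refl = inj₂ (b , sym (component-trivial partner (reach-sym r)))
  ... | inj₁ r     = ⊥-elim (reach-end∉ r (e∈I zero))
  ... | inj₂ found = found

  matching : Fin (suc k) ⊎ Fin (suc k) → Fin n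
  matching = [ e , y ]′

  matching-injective : Injective _≡_ _≡_ matching
  matching-injective {inj₁ a} {inj₁ b} eq = cong inj₁ (e-injective eq)
  matching-injective {inj₂ a} {inj₂ b} eq = cong inj₂ (y-injective eq)
  matching-injective {inj₁ a} {inj₂ b} eq = ⊥-elim (y∉I b (subst (_∈ I) eq (e∈I a)))
  matching-injective {inj₂ a} {inj₁ b} eq = ⊥-elim (y∉I a (subst (_∈ I) (sym eq) (e∈I b)))

  matching-surjective : StrictlySurjective _≡_ matching
  matching-surjective v with v ∈? I
  ... | yes v∈I with ∈-imageOf⁻ e v∈I
  ...   | a , ea≡v = inj₁ a , ea≡v
  matching-surjective v | no v∉I with outside-is-partner v∉I
  ...   | b , yb≡v = inj₂ b , yb≡v

  matching-adjacency : ∀ c d → adj G (matching c) (matching d) ≡ kpmAdj′ c d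
  matching-adjacency (inj₁ a) (inj₁ b) = e-independent a b
  matching-adjacency (inj₁ a) (inj₂ b) = partner-adjacency a b
  matching-adjacency (inj₂ a) (inj₁ b) = trans (adj-sym _ _) (trans (partner-adjacency b a) (neqB-sym b a))
  matching-adjacency (inj₂ a) (inj₂ b) = partners-independent a b

  unique : G ≅ KssMinusPM (suc k)
  unique = Crown.crown-≅ k G matching matching-injective matching-surjective matching-adjacency

theorem1 : (k : ℕ) → 3 ≤ k →
    Conditions (KssMinusPM (suc k)) k ×
    (∀ (n : ℕ) (G : Graph n) → Conditions G k → G ≅ KssMinusPM (suc k))
theorem1 k 3≤k = (crown-connected (≤-trans (n≤1+n 2) 3≤k) , crown-independence , crown-cuts 3≤k) , unique
  where
  open Crown k
  unique : ∀ (n : ℕ) (G : Graph n) → Conditions G k → G ≅ KssMinusPM (suc k)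
  unique n G ((_ , connected) , (S , S-independent , k<∣S∣) , cuts) with enumerate S
  ... | e , e-injective , e∈S =
    Uniqueness.unique G 3≤k connected cuts (e ∘ λ i → inject≤ i k<∣S∣)
      (inject≤-injective k<∣S∣ k<∣S∣ _ _ ∘ e-injective) (λ a b → S-independent _ _ (e∈S _) (e∈S _))
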